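{- For a PCF program $P$ having type $\mathsf{int}$, we have $P\twoheadrightarrow_{\sf PCF}\underline n\iff P\twoheadrightarrow_{\mathtt{wh}}\underline n$.
   Context: $\twoheadrightarrow_{\sf PCF}$ is the reflexive-transitive closure of the call-by-name weak head reduction of PCF. EPCF extends PCF with (closed) explicit substitutions $M\langle x/N\rangle$; every PCF program is an EPCF program. $\to_{\mathtt{wh}}$ is the weak head reduction of EPCF: the union of computation steps ($\beta$-step $(\lambda x.M)^\sigma N\to M^\sigma\langle x/N\rangle$ where $\sigma$ is a list of explicit substitutions, and the usual $\mathbf{pred}$, $\mathbf{ifz}$, $\mathbf{fix}$ rules) and percolation steps pushing explicit substitutions inward (e.g. $x^\sigma\to\sigma(x)$, $(M N)^\sigma\to M^\sigma N^\sigma$), all under evaluation contexts; $\twoheadrightarrow_{\mathtt{wh}}$ is its reflexive-transitive closure. $\underline n=\mathbf{succ}^n(\mathbf0)$. -}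

module Defs where

open import Data.Nat using (ℕ; zero; suc)
open import Data.Fin using (Fin) renaming (zero to fz; suc to fs)
open import Data.Vec using (Vec; []; _∷_; lookup)
open import Relation.Binary.Construct.Closure.ReflexiveTransitive using (Star)

infixr 7 _⇒_
data Ty : Set where
  int : Ty
  _⇒_ : Ty → Ty → Ty

data Tm (n : ℕ) : Set where
  var  : Fin n → Tm n
  lam  : Tm (suc n) → Tm n
  app  : Tm n → Tm n → Tm n
  zro  : Tm n
  succ : Tm n → Tm n
  pred : Tm n → Tm n
  ifz  : Tm n → Tm n → Tm n → Tm n
  fix  : Tm n → Tm n

num : ∀ {m} → ℕ → Tm m
num zero    = zro
num (suc k) = succ (num k)

Ctx : ℕ → Set
Ctx n = Vec Ty n

infix 4 _⊢_∶_
data _⊢_∶_ {n : ℕ} (Γ : Ctx n) : Tm n → Ty → Set where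
  ⊢var  : ∀ i → Γ ⊢ var i ∶ lookup Γ i
  ⊢lam  : ∀ {A B M} → (A ∷ Γ) ⊢ M ∶ B → Γ ⊢ lam M ∶ A ⇒ B
  ⊢app  : ∀ {A B M N} → Γ ⊢ M ∶ A ⇒ B → Γ ⊢ N ∶ A → Γ ⊢ app M N ∶ B
  ⊢zro  : Γ ⊢ zro ∶ int
  ⊢succ : ∀ {M} → Γ ⊢ M ∶ int → Γ ⊢ succ M ∶ int
  ⊢pred : ∀ {M} → Γ ⊢ M ∶ int → Γ ⊢ pred M ∶ int
  ⊢ifz  : ∀ {A L M N} → Γ ⊢ L ∶ int → Γ ⊢ M ∶ A → Γ ⊢ N ∶ A → Γ ⊢ ifz L M N ∶ A
  ⊢fix  : ∀ {A M} → Γ ⊢ M ∶ A ⇒ A → Γ ⊢ fix M ∶ A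

Ren : ℕ → ℕ → Set
Ren m n = Fin m → Fin n

ext : ∀ {m n} → Ren m n → Ren (suc m) (suc n)
ext ρ fz     = fz
ext ρ (fs i) = fs (ρ i)

rename : ∀ {m n} → Ren m n → Tm m → Tm n
rename ρ (var i)     = var (ρ i)
rename ρ (lam M)     = lam (rename (ext ρ) M)
rename ρ (app M N)   = app (rename ρ M) (rename ρ N)
rename ρ zro         = zro
rename ρ (succ M)    = succ (rename ρ M)
rename ρ (pred M)    = pred (rename ρ M)
rename ρ (ifz L M N) = ifz (rename ρ L) (rename ρ M) (rename ρ N)
rename ρ (fix M)     = fix (rename ρ M)

Sub : ℕ → ℕ → Set
Sub m n = Fin m → Tm n

exts : ∀ {m n} → Sub m n → Sub (suc m) (suc n)
exts σ fz     = var fz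
exts σ (fs i) = rename fs (σ i)

subst : ∀ {m n} → Sub m n → Tm m → Tm n
subst σ (var i)     = σ i
subst σ (lam M)     = lam (subst (exts σ) M)
subst σ (app M N)   = app (subst σ M) (subst σ N)
subst σ zro         = zro
subst σ (succ M)    = succ (subst σ M)
subst σ (pred M)    = pred (subst σ M)
subst σ (ifz L M N) = ifz (subst σ L) (subst σ M) (subst σ N)
subst σ (fix M)     = fix (subst σ M)

single : ∀ {n} → Tm n → Sub (suc n) n
single N fz     = N
single N (fs i) = var i

_[_] : ∀ {n} → Tm (suc n) → Tm n → Tm n
M [ N ] = subst (single N) M

infix 4 _→pcf_ _↠pcf_
data _→pcf_ : Tm 0 → Tm 0 → Set where
  β      : ∀ {M N} → app (lam M) N →pcf M [ N ]
  pred0  : pred zro →pcf zro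
  predS  : ∀ k → pred (succ (num k)) →pcf num k
  ifz0   : ∀ {M N} → ifz zro M N →pcf M
  ifzS   : ∀ k {M N} → ifz (succ (num k)) M N →pcf N
  fixβ   : ∀ {M} → fix M →pcf app M (fix M)
  -- evaluation contexts  E ::= [] | E N | succ E | pred E | ifz(E, M, N)
  ξapp   : ∀ {M M' N} → M →pcf M' → app M N →pcf app M' N
  ξsucc  : ∀ {M M'} → M →pcf M' → succ M →pcf succ M'
  ξpred  : ∀ {M M'} → M →pcf M' → pred M →pcf pred M'
  ξifz   : ∀ {L L' M N} → L →pcf L' → ifz L M N →pcf ifz L' M N

_↠pcf_ : Tm 0 → Tm 0 → Set
_↠pcf_ = Star _→pcf_

-- EPCF: PCF + closed explicit substitutions  esub M N = M⟨x/N⟩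
-- (M binds de Bruijn variable 0 = x, N is closed)

data ETm (n : ℕ) : Set where
  var  : Fin n → ETm n
  lam  : ETm (suc n) → ETm n
  app  : ETm n → ETm n → ETm n
  zro  : ETm n
  succ : ETm n → ETm n
  pred : ETm n → ETm n
  ifz  : ETm n → ETm n → ETm n → ETm n
  fix  : ETm n → ETm n
  esub : ETm (suc n) → ETm 0 → ETm n

embed : ∀ {n} → Tm n → ETm n
embed (var i)     = var i
embed (lam M)     = lam (embed M)
embed (app M N)   = app (embed M) (embed N)
embed zro         = zro
embed (succ M)    = succ (embed M)
embed (pred M)    = pred (embed M)
embed (ifz L M N) = ifz (embed L) (embed M) (embed N)
embed (fix M)     = fix (embed M)

enum : ∀ {m} → ℕ → ETm m
enum zero    = zro
enum (suc k) = succ (enum k)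

-- list of closed explicit substitutions: M ^ (N₀ ∷ N₁ ∷ …) = M⟨N₀⟩⟨N₁⟩…
-- (N₀ substitutes de Bruijn variable 0 of M, etc.)
Env : ℕ → Set
Env k = Vec (ETm 0) k

_^_ : ∀ {k} → ETm k → Env k → ETm 0
M ^ []      = M
M ^ (N ∷ σ) = esub M N ^ σ

infix 4 _→wh_ _↠wh_
data _→wh_ : ETm 0 → ETm 0 → Set where
  β      : ∀ {k M N} (σ : Env k) → app (lam M ^ σ) N →wh (esub M N ^ σ)
  pred0  : pred zro →wh zro
  predS  : ∀ k → pred (succ (enum k)) →wh enum k
  ifz0   : ∀ {M N} → ifz zro M N →wh M
  ifzS   : ∀ k {M N} → ifz (succ (enum k)) M N →wh N
  fixβ   : ∀ {M} → fix M →wh app M (fix M)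
  πvar   : ∀ {k} (i : Fin (suc k)) (σ : Env (suc k)) → var i ^ σ →wh lookup σ i
  πapp   : ∀ {k M N} (σ : Env (suc k)) → app M N ^ σ →wh app (M ^ σ) (N ^ σ)
  πzro   : ∀ {k} (σ : Env (suc k)) → zro ^ σ →wh zro
  πsucc  : ∀ {k M} (σ : Env (suc k)) → succ M ^ σ →wh succ (M ^ σ)
  πpred  : ∀ {k M} (σ : Env (suc k)) → pred M ^ σ →wh pred (M ^ σ)
  πifz   : ∀ {k L M N} (σ : Env (suc k)) → ifz L M N ^ σ →wh ifz (L ^ σ) (M ^ σ) (N ^ σ)
  πfix   : ∀ {k M} (σ : Env (suc k)) → fix M ^ σ →wh fix (M ^ σ)
  -- evaluation contexts  E ::= [] | E N | succ E | pred E | ifz(E, M, N)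
  ξapp   : ∀ {M M' N} → M →wh M' → app M N →wh app M' N
  ξsucc  : ∀ {M M'} → M →wh M' → succ M →wh succ M'
  ξpred  : ∀ {M M'} → M →wh M' → pred M →wh pred M'
  ξifz   : ∀ {L L' M N} → L →wh L' → ifz L M N →wh ifz L' M N

_↠wh_ : ETm 0 → ETm 0 → Set
_↠wh_ = Star _→wh_

-- Unfolding every explicit substitution (M⟨x/N⟩ ↦ M[N/x]) maps EPCF programs onto PCF programs.
-- Under unfolding a percolation step is an identity and a computation step is one PCF step,
-- which gives ⇐. For ⇒, every EPCF program percolates to one whose head is a term former
-- (or a λ under substitutions) with the same unfolding; a PCF step from that unfolding is then
-- matched by one computation step, after percolating the redex's subterms as needed.
module Submission where

open import Defs
open import Data.Nat using (ℕ; zero; suc)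
open import Data.Fin using () renaming (zero to fz; suc to fs)
open import Data.Vec using ([]; _∷_; lookup)
open import Data.Product using (Σ; _×_; _,_)
open import Function.Bundles using (_⇔_; mk⇔)
open import Relation.Binary.PropositionalEquality
  using (_≡_; refl; sym; trans; cong; cong₂; subst₂; module ≡-Reasoning) renaming (subst to transport)
open import Relation.Binary.Construct.Closure.Reflexive as Refl using (ReflClosure; refl)
open import Relation.Binary.Construct.Closure.ReflexiveTransitive
  using (Star; ε; _◅_; _◅◅_; gmap; return)

cong₃ : ∀ {A B C D : Set} (f : A → B → C → D) {a a' b b' c c'} →
        a ≡ a' → b ≡ b' → c ≡ c' → f a b c ≡ f a' b' c'
cong₃ f refl refl refl = refl

ext-cong : ∀ {m n} {ρ ρ' : Ren m n} → (∀ i → ρ i ≡ ρ' i) → ∀ i → ext ρ i ≡ ext ρ' i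
ext-cong h fz     = refl
ext-cong h (fs i) = cong fs (h i)

rename-cong : ∀ {m n} {ρ ρ' : Ren m n} → (∀ i → ρ i ≡ ρ' i) → ∀ M → rename ρ M ≡ rename ρ' M
rename-cong h (var i)     = cong var (h i)
rename-cong h (lam M)     = cong lam (rename-cong (ext-cong h) M)
rename-cong h (app M N)   = cong₂ app (rename-cong h M) (rename-cong h N)
rename-cong h zro         = refl
rename-cong h (succ M)    = cong succ (rename-cong h M)
rename-cong h (pred M)    = cong pred (rename-cong h M)
rename-cong h (ifz L M N) = cong₃ ifz (rename-cong h L) (rename-cong h M) (rename-cong h N)
rename-cong h (fix M)     = cong fix (rename-cong h M)

exts-cong : ∀ {m n} {σ σ' : Sub m n} → (∀ i → σ i ≡ σ' i) → ∀ i → exts σ i ≡ exts σ' i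
exts-cong h fz     = refl
exts-cong h (fs i) = cong (rename fs) (h i)

subst-cong : ∀ {m n} {σ σ' : Sub m n} → (∀ i → σ i ≡ σ' i) → ∀ M → subst σ M ≡ subst σ' M
subst-cong h (var i)     = h i
subst-cong h (lam M)     = cong lam (subst-cong (exts-cong h) M)
subst-cong h (app M N)   = cong₂ app (subst-cong h M) (subst-cong h N)
subst-cong h zro         = refl
subst-cong h (succ M)    = cong succ (subst-cong h M)
subst-cong h (pred M)    = cong pred (subst-cong h M)
subst-cong h (ifz L M N) = cong₃ ifz (subst-cong h L) (subst-cong h M) (subst-cong h N)
subst-cong h (fix M)     = cong fix (subst-cong h M)

rename-∘ : ∀ {l m n} (ρ : Ren m n) (ρ' : Ren l m) M →
           rename ρ (rename ρ' M) ≡ rename (λ i → ρ (ρ' i)) M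
rename-∘ ρ ρ' (var i)     = refl
rename-∘ ρ ρ' (lam M)     = cong lam (trans (rename-∘ (ext ρ) (ext ρ') M) (rename-cong ext-∘ M))
  where
  ext-∘ : ∀ i → ext ρ (ext ρ' i) ≡ ext (λ j → ρ (ρ' j)) i
  ext-∘ fz     = refl
  ext-∘ (fs i) = refl
rename-∘ ρ ρ' (app M N)   = cong₂ app (rename-∘ ρ ρ' M) (rename-∘ ρ ρ' N)
rename-∘ ρ ρ' zro         = refl
rename-∘ ρ ρ' (succ M)    = cong succ (rename-∘ ρ ρ' M)
rename-∘ ρ ρ' (pred M)    = cong pred (rename-∘ ρ ρ' M)
rename-∘ ρ ρ' (ifz L M N) = cong₃ ifz (rename-∘ ρ ρ' L) (rename-∘ ρ ρ' M) (rename-∘ ρ ρ' N)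
rename-∘ ρ ρ' (fix M)     = cong fix (rename-∘ ρ ρ' M)

subst-rename : ∀ {l m n} (τ : Sub m n) (ρ : Ren l m) M →
               subst τ (rename ρ M) ≡ subst (λ i → τ (ρ i)) M
subst-rename τ ρ (var i)     = refl
subst-rename τ ρ (lam M)     = cong lam (trans (subst-rename (exts τ) (ext ρ) M) (subst-cong exts-ext M))
  where
  exts-ext : ∀ i → exts τ (ext ρ i) ≡ exts (λ j → τ (ρ j)) i
  exts-ext fz     = refl
  exts-ext (fs i) = refl
subst-rename τ ρ (app M N)   = cong₂ app (subst-rename τ ρ M) (subst-rename τ ρ N)
subst-rename τ ρ zro         = refl
subst-rename τ ρ (succ M)    = cong succ (subst-rename τ ρ M)
subst-rename τ ρ (pred M)    = cong pred (subst-rename τ ρ M)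
subst-rename τ ρ (ifz L M N) = cong₃ ifz (subst-rename τ ρ L) (subst-rename τ ρ M) (subst-rename τ ρ N)
subst-rename τ ρ (fix M)     = cong fix (subst-rename τ ρ M)

rename-subst : ∀ {l m n} (ρ : Ren m n) (σ : Sub l m) M →
               rename ρ (subst σ M) ≡ subst (λ i → rename ρ (σ i)) M
rename-subst ρ σ (var i)     = refl
rename-subst ρ σ (lam M)     = cong lam (trans (rename-subst (ext ρ) (exts σ) M) (subst-cong ext-exts M))
  where
  ext-exts : ∀ i → rename (ext ρ) (exts σ i) ≡ exts (λ j → rename ρ (σ j)) i
  ext-exts fz     = refl
  ext-exts (fs i) = trans (rename-∘ (ext ρ) fs (σ i)) (sym (rename-∘ fs ρ (σ i)))
rename-subst ρ σ (app M N)   = cong₂ app (rename-subst ρ σ M) (rename-subst ρ σ N)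
rename-subst ρ σ zro         = refl
rename-subst ρ σ (succ M)    = cong succ (rename-subst ρ σ M)
rename-subst ρ σ (pred M)    = cong pred (rename-subst ρ σ M)
rename-subst ρ σ (ifz L M N) = cong₃ ifz (rename-subst ρ σ L) (rename-subst ρ σ M) (rename-subst ρ σ N)
rename-subst ρ σ (fix M)     = cong fix (rename-subst ρ σ M)

subst-∘ : ∀ {l m n} (τ : Sub m n) (σ : Sub l m) M →
          subst τ (subst σ M) ≡ subst (λ i → subst τ (σ i)) M
subst-∘ τ σ (var i)     = refl
subst-∘ τ σ (lam M)     = cong lam (trans (subst-∘ (exts τ) (exts σ) M) (subst-cong exts-∘ M))
  where
  exts-∘ : ∀ i → subst (exts τ) (exts σ i) ≡ exts (λ j → subst τ (σ j)) i
  exts-∘ fz     = refl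
  exts-∘ (fs i) = trans (subst-rename (exts τ) fs (σ i)) (sym (rename-subst fs τ (σ i)))
subst-∘ τ σ (app M N)   = cong₂ app (subst-∘ τ σ M) (subst-∘ τ σ N)
subst-∘ τ σ zro         = refl
subst-∘ τ σ (succ M)    = cong succ (subst-∘ τ σ M)
subst-∘ τ σ (pred M)    = cong pred (subst-∘ τ σ M)
subst-∘ τ σ (ifz L M N) = cong₃ ifz (subst-∘ τ σ L) (subst-∘ τ σ M) (subst-∘ τ σ N)
subst-∘ τ σ (fix M)     = cong fix (subst-∘ τ σ M)

subst-id : ∀ {n} (M : Tm n) → subst var M ≡ M
subst-id (var i)     = refl
subst-id (lam M)     = cong lam (trans (subst-cong exts-var M) (subst-id M))
  where
  exts-var : ∀ i → exts var i ≡ var i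
  exts-var fz     = refl
  exts-var (fs i) = refl
subst-id (app M N)   = cong₂ app (subst-id M) (subst-id N)
subst-id zro         = refl
subst-id (succ M)    = cong succ (subst-id M)
subst-id (pred M)    = cong pred (subst-id M)
subst-id (ifz L M N) = cong₃ ifz (subst-id L) (subst-id M) (subst-id N)
subst-id (fix M)     = cong fix (subst-id M)

subst-closed : (σ : Sub 0 0) (M : Tm 0) → subst σ M ≡ M
subst-closed σ M = trans (subst-cong (λ ()) M) (subst-id M)

weaken : ∀ {k} → Tm 0 → Tm k
weaken = rename (λ ())

subst-weaken : ∀ {k} (τ : Sub k 0) M → subst τ (weaken M) ≡ M
subst-weaken τ M = trans (subst-rename τ (λ ()) M) (subst-closed _ M)

unfold : ∀ {k} → ETm k → Tm k
unfold (var i)     = var i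
unfold (lam M)     = lam (unfold M)
unfold (app M N)   = app (unfold M) (unfold N)
unfold zro         = zro
unfold (succ M)    = succ (unfold M)
unfold (pred M)    = pred (unfold M)
unfold (ifz L M N) = ifz (unfold L) (unfold M) (unfold N)
unfold (fix M)     = fix (unfold M)
unfold (esub M N)  = unfold M [ weaken (unfold N) ]

unfoldEnv : ∀ {k} → Env k → Sub k 0
unfoldEnv σ i = unfold (lookup σ i)

unfold-^ : ∀ {k} (X : ETm k) (σ : Env k) → unfold (X ^ σ) ≡ subst (unfoldEnv σ) (unfold X)
unfold-^ X []      = sym (subst-closed _ (unfold X))
unfold-^ X (N ∷ σ) = trans (unfold-^ (esub X N) σ)
  (trans (subst-∘ (unfoldEnv σ) (single (weaken (unfold N))) (unfold X)) (subst-cong env-∷ (unfold X)))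
  where
  env-∷ : ∀ i → subst (unfoldEnv σ) (single (weaken (unfold N)) i) ≡ unfoldEnv (N ∷ σ) i
  env-∷ fz     = subst-weaken (unfoldEnv σ) (unfold N)
  env-∷ (fs i) = refl

subst-exts-[] : ∀ {k} (σ : Env k) N Y →
                subst (exts (unfoldEnv σ)) Y [ unfold N ] ≡ subst (unfoldEnv (N ∷ σ)) Y
subst-exts-[] σ N Y = trans (subst-∘ (single (unfold N)) (exts (unfoldEnv σ)) Y) (subst-cong single-exts Y)
  where
  single-exts : ∀ i → subst (single (unfold N)) (exts (unfoldEnv σ) i) ≡ unfoldEnv (N ∷ σ) i
  single-exts fz     = refl
  single-exts (fs i) = trans (subst-rename (single (unfold N)) fs (unfoldEnv σ i))
                             (subst-closed _ (unfoldEnv σ i))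

unfold-enum : ∀ {k} n → unfold {k} (enum n) ≡ num n
unfold-enum zero    = refl
unfold-enum (suc n) = cong succ (unfold-enum n)

unfold-embed : ∀ {k} (M : Tm k) → unfold (embed M) ≡ M
unfold-embed (var i)     = refl
unfold-embed (lam M)     = cong lam (unfold-embed M)
unfold-embed (app M N)   = cong₂ app (unfold-embed M) (unfold-embed N)
unfold-embed zro         = refl
unfold-embed (succ M)    = cong succ (unfold-embed M)
unfold-embed (pred M)    = cong pred (unfold-embed M)
unfold-embed (ifz L M N) = cong₃ ifz (unfold-embed L) (unfold-embed M) (unfold-embed N)
unfold-embed (fix M)     = cong fix (unfold-embed M)

unfold-→ : ∀ {E E'} → E →wh E' → ReflClosure _→pcf_ (unfold E) (unfold E')
unfold-→ (β {M = M} {N} σ) = Refl.[ subst₂ _→pcf_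
  (cong (λ t → app t (unfold N)) (sym (unfold-^ (lam M) σ)))
  (trans (subst-exts-[] σ N (unfold M)) (sym (unfold-^ M (N ∷ σ)))) β ]
unfold-→ pred0     = Refl.[ pred0 ]
unfold-→ (predS k) = Refl.[ transport (λ t → pred (succ t) →pcf t) (sym (unfold-enum k)) (predS k) ]
unfold-→ ifz0      = Refl.[ ifz0 ]
unfold-→ (ifzS k)  = Refl.[ transport (λ t → ifz (succ t) _ _ →pcf _) (sym (unfold-enum k)) (ifzS k) ]
unfold-→ fixβ      = Refl.[ fixβ ]
unfold-→ (πvar i σ) = Refl.reflexive (unfold-^ (var i) σ)
unfold-→ (πapp {M = M} {N} σ) =
  Refl.reflexive (trans (unfold-^ (app M N) σ) (sym (cong₂ app (unfold-^ M σ) (unfold-^ N σ))))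
unfold-→ (πzro σ) = Refl.reflexive (unfold-^ zro σ)
unfold-→ (πsucc {M = M} σ) = Refl.reflexive (trans (unfold-^ (succ M) σ) (sym (cong succ (unfold-^ M σ))))
unfold-→ (πpred {M = M} σ) = Refl.reflexive (trans (unfold-^ (pred M) σ) (sym (cong pred (unfold-^ M σ))))
unfold-→ (πifz {L = L} {M} {N} σ) = Refl.reflexive (trans (unfold-^ (ifz L M N) σ)
  (sym (cong₃ ifz (unfold-^ L σ) (unfold-^ M σ) (unfold-^ N σ))))
unfold-→ (πfix {M = M} σ) = Refl.reflexive (trans (unfold-^ (fix M) σ) (sym (cong fix (unfold-^ M σ))))
unfold-→ (ξapp s)  = Refl.map ξapp (unfold-→ s)
unfold-→ (ξsucc s) = Refl.map ξsucc (unfold-→ s)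
unfold-→ (ξpred s) = Refl.map ξpred (unfold-→ s)
unfold-→ (ξifz s)  = Refl.map ξifz (unfold-→ s)

_◅?_ : ∀ {A : Set} {R : A → A → Set} {x y z} → ReflClosure R x y → Star R y z → Star R x z
refl       ◅? ys = ys
Refl.[ r ] ◅? ys = r ◅ ys

unfold-↠ : ∀ {E E'} → E ↠wh E' → unfold E ↠pcf unfold E'
unfold-↠ ε        = ε
unfold-↠ (s ◅ ss) = unfold-→ s ◅? unfold-↠ ss

-- Exposed F P: F is built by a term former, or is a λ under explicit substitutions, and unfolds
-- to P. The unfoldings of the immediate subterms are given up to ≡, so that the top constructor
-- of P can be matched on (as in a PCF redex) while the subterms stay arbitrary.
data Exposed : ETm 0 → Tm 0 → Set where
  lam  : ∀ {k M} (X : ETm (suc k)) (σ : Env k) →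
         subst (exts (unfoldEnv σ)) (unfold X) ≡ M → Exposed (lam X ^ σ) (lam M)
  app  : ∀ {A B P Q} → unfold A ≡ P → unfold B ≡ Q → Exposed (app A B) (app P Q)
  zro  : Exposed zro zro
  succ : ∀ {A P} → unfold A ≡ P → Exposed (succ A) (succ P)
  pred : ∀ {A P} → unfold A ≡ P → Exposed (pred A) (pred P)
  ifz  : ∀ {A B C P Q R} → unfold A ≡ P → unfold B ≡ Q → unfold C ≡ R →
         Exposed (ifz A B C) (ifz P Q R)
  fix  : ∀ {A P} → unfold A ≡ P → Exposed (fix A) (fix P)

Percolates : ETm 0 → Tm 0 → Set
Percolates E P = Σ (ETm 0) λ F → (E ↠wh F) × Exposed F P

exposed-^ : ∀ {k F} (X : ETm k) (σ : Env k) →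
            Exposed F (subst (unfoldEnv σ) (unfold X)) → Exposed F (unfold (X ^ σ))
exposed-^ X σ = transport (Exposed _) (sym (unfold-^ X σ))

-- The entries of σ are not subterms of X; their percolations are supplied for the var case.
percolate-^ : ∀ {k} (X : ETm k) (σ : Env k) →
              (∀ i → Percolates (lookup σ i) (unfold (lookup σ i))) → Percolates (X ^ σ) (unfold (X ^ σ))
percolate : ∀ E → Percolates E (unfold E)

percolate E = percolate-^ E [] (λ ())

percolate-^ {suc k} (var i) σ ps with ps i
... | F , r , x = F , πvar i σ ◅ r , exposed-^ (var i) σ x
percolate-^ (esub X N) σ ps = percolate-^ X (N ∷ σ) λ { fz → percolate N ; (fs i) → ps i }
percolate-^ (lam X) σ ps = lam X ^ σ , ε , exposed-^ (lam X) σ (lam X σ refl)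
percolate-^ (app A B) []  ps = _ , ε , app refl refl
percolate-^ (app A B) σ@(_ ∷ _) ps =
  _ , return (πapp σ) , exposed-^ (app A B) σ (app (unfold-^ A σ) (unfold-^ B σ))
percolate-^ zro []  ps = _ , ε , zro
percolate-^ zro σ@(_ ∷ _) ps = _ , return (πzro σ) , exposed-^ zro σ zro
percolate-^ (succ A) []  ps = _ , ε , succ refl
percolate-^ (succ A) σ@(_ ∷ _) ps = _ , return (πsucc σ) , exposed-^ (succ A) σ (succ (unfold-^ A σ))
percolate-^ (pred A) []  ps = _ , ε , pred refl
percolate-^ (pred A) σ@(_ ∷ _) ps = _ , return (πpred σ) , exposed-^ (pred A) σ (pred (unfold-^ A σ))
percolate-^ (ifz A B C) []  ps = _ , ε , ifz refl refl refl
percolate-^ (ifz A B C) σ@(_ ∷ _) ps =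
  _ , return (πifz σ) , exposed-^ (ifz A B C) σ (ifz (unfold-^ A σ) (unfold-^ B σ) (unfold-^ C σ))
percolate-^ (fix A) []  ps = _ , ε , fix refl
percolate-^ (fix A) σ@(_ ∷ _) ps = _ , return (πfix σ) , exposed-^ (fix A) σ (fix (unfold-^ A σ))

percolate-≡ : ∀ E {P} → unfold E ≡ P → Percolates E P
percolate-≡ E e = transport (Percolates E) e (percolate E)

unfold≡num⇒↠enum : ∀ E n → unfold E ≡ num n → E ↠wh enum n
exposed-num⇒↠enum : ∀ {F} n → Exposed F (num n) → F ↠wh enum n

unfold≡num⇒↠enum E n e = let F , r , x = percolate-≡ E e in r ◅◅ exposed-num⇒↠enum n x

exposed-num⇒↠enum zero    zro             = ε
exposed-num⇒↠enum (suc n) (succ {A = A} e) = gmap succ ξsucc (unfold≡num⇒↠enum A n e)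

Reaches : ETm 0 → Tm 0 → Set
Reaches E Q = Σ (ETm 0) λ E' → (E ↠wh E') × (unfold E' ≡ Q)

reaches-under : ∀ {E Q} (C : ETm 0 → ETm 0) (C' : Tm 0 → Tm 0) →
                (∀ {E E'} → E →wh E' → C E →wh C E') → (∀ E → unfold (C E) ≡ C' (unfold E)) →
                Reaches E Q → Reaches (C E) (C' Q)
reaches-under C C' ξ unfold-C (E' , r , e) = C E' , gmap C ξ r , trans (unfold-C E') (cong C' e)

simulate-→ : ∀ E {P Q} → unfold E ≡ P → P →pcf Q → Reaches E Q
simulate-exposed : ∀ {F P Q} → Exposed F P → P →pcf Q → Reaches F Q

simulate-→ E e s = let F , r , x = percolate-≡ E e ; E' , r' , e' = simulate-exposed x s in
                   E' , r ◅◅ r' , e'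

simulate-exposed (app {A = A} {B} eA eB) (β {M = M} {N}) with percolate-≡ A eA
... | _ , r , lam X σ eX = esub X B ^ σ , gmap (λ t → app t B) ξapp r ◅◅ return (β σ) , (begin
  unfold (X ^ (B ∷ σ))                              ≡⟨ unfold-^ X (B ∷ σ) ⟩
  subst (unfoldEnv (B ∷ σ)) (unfold X)              ≡⟨ sym (subst-exts-[] σ B (unfold X)) ⟩
  subst (exts (unfoldEnv σ)) (unfold X) [ unfold B ] ≡⟨ cong₂ _[_] eX eB ⟩
  M [ N ]                                            ∎)
  where open ≡-Reasoning
simulate-exposed (app {B = B} eA eB) (ξapp s) =
  reaches-under (λ t → app t B) (λ t → app t _) ξapp (λ _ → cong (app _) eB) (simulate-→ _ eA s)
simulate-exposed (succ eA) (ξsucc s) = reaches-under succ succ ξsucc (λ _ → refl) (simulate-→ _ eA s)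
simulate-exposed (pred {A = A} eA) pred0 =
  zro , gmap pred ξpred (unfold≡num⇒↠enum A 0 eA) ◅◅ return pred0 , refl
simulate-exposed (pred {A = A} eA) (predS k) =
  enum k , gmap pred ξpred (unfold≡num⇒↠enum A (suc k) eA) ◅◅ return (predS k) , unfold-enum k
simulate-exposed (pred eA) (ξpred s) = reaches-under pred pred ξpred (λ _ → refl) (simulate-→ _ eA s)
simulate-exposed (ifz {A = A} {B} {C} eA eB eC) ifz0 =
  B , gmap (λ t → ifz t B C) ξifz (unfold≡num⇒↠enum A 0 eA) ◅◅ return ifz0 , eB
simulate-exposed (ifz {A = A} {B} {C} eA eB eC) (ifzS k) =
  C , gmap (λ t → ifz t B C) ξifz (unfold≡num⇒↠enum A (suc k) eA) ◅◅ return (ifzS k) , eC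
simulate-exposed (ifz {B = B} {C} eA eB eC) (ξifz s) =
  reaches-under (λ t → ifz t B C) (λ t → ifz t _ _) ξifz (λ _ → cong₂ (ifz _) eB eC) (simulate-→ _ eA s)
simulate-exposed (fix {A = A} eA) fixβ = app A (fix A) , return fixβ , cong₂ app eA (cong fix eA)

simulate-↠ : ∀ E {P Q} → unfold E ≡ P → P ↠pcf Q → Reaches E Q
simulate-↠ E e ε        = E , ε , e
simulate-↠ E e (s ◅ ss) = let E₁ , r₁ , e₁ = simulate-→ E e s ; E₂ , r₂ , e₂ = simulate-↠ E₁ e₁ ss in
                          E₂ , r₁ ◅◅ r₂ , e₂

theorem2p23 : (P : Tm 0) (n : ℕ) → [] ⊢ P ∶ int →
    (P ↠pcf num n) ⇔ (embed P ↠wh enum n)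
theorem2p23 P n _ = mk⇔ to from
  where
  to : P ↠pcf num n → embed P ↠wh enum n
  to ps = let E , r , e = simulate-↠ (embed P) (unfold-embed P) ps in r ◅◅ unfold≡num⇒↠enum E n e

  from : embed P ↠wh enum n → P ↠pcf num n
  from r = subst₂ _↠pcf_ (unfold-embed P) (unfold-enum n) (unfold-↠ r)
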